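{- Let $G$ be a connected graph with at least two edges and let $L(G)$ be its line graph. Then $\mathrm{rd}(G)\leq \mathrm{rvd}(L(G))$.
   Context: The line graph $L(G)$ has vertex set $E(G)$, two edges being adjacent iff they share an end. Edge-colorings: a rainbow-cut is an edge-cut whose edges have pairwise distinct colors; $G$ is rainbow disconnected if every two distinct vertices $u,v$ lie in different components of $G-R$ for some rainbow-cut $R$; $\mathrm{rd}(G)$ is the minimum number of colors making $G$ rainbow disconnected. Vertex-colorings of a connected graph $H$: for vertices $x,y$, if nonadjacent an $x$-$y$-vertex-cut is a set $S\subseteq V(H)$ with $x,y$ in different components of $H-S$; if adjacent, it is a set $S$ with $x,y$ in different components of $(H-xy)-S$. A set of vertices is rainbow if its vertices have distinct colors. An $x$-$y$-rainbow-vertex-cut is an $x$-$y$-vertex-cut $S$ such that $S$ is rainbow if $x,y$ are nonadjacent, and $S\cup\{x\}$ or $S\cup\{y\}$ is rainbow if $x,y$ are adjacent. $H$ is rainbow vertex-disconnected if every two vertices $x,y$ have an $x$-$y$-rainbow-vertex-cut; $\mathrm{rvd}(H)$ is the minimum number of colors of a vertex-coloring making $H$ rainbow vertex-disconnected. -}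

module Defs where

open import Data.Nat using (ℕ; _≤_)
open import Data.Fin using (Fin; _<_)
open import Data.Bool using (Bool; true; false)
open import Data.Product using (Σ; Σ-syntax; ∃; ∃-syntax; _×_; _,_)
open import Data.Sum using (_⊎_)
open import Data.Empty using (⊥)
open import Relation.Nullary using (¬_)
open import Relation.Binary.PropositionalEquality using (_≡_; _≢_)
open import Relation.Binary.Construct.Closure.ReflexiveTransitive using (Star)

record SimpleGraph (n : ℕ) : Set where
  field
    adj    : Fin n → Fin n → Bool
    sym    : ∀ i j → adj i j ≡ adj j i
    irrefl : ∀ i → adj i i ≡ false
open SimpleGraph public

-- An edge {u,v} is stored once, with u < v.
record Edge {n : ℕ} (G : SimpleGraph n) : Set where
  constructor edge
  field
    u     : Fin n
    v     : Fin n
    u<v   : u < v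
    isAdj : adj G u v ≡ true
open Edge public

HasEnd : ∀ {n} {G : SimpleGraph n} → Edge G → Fin n → Set
HasEnd e x = (x ≡ u e) ⊎ (x ≡ v e)

Adjacent : ∀ {n} → SimpleGraph n → Fin n → Fin n → Set
Adjacent G i j = adj G i j ≡ true

Connected : ∀ {n} → SimpleGraph n → Set
Connected G = ∀ x y → Star (Adjacent G) x y

AtLeastTwoEdges : ∀ {n} → SimpleGraph n → Set
AtLeastTwoEdges G = Σ[ e ∈ Edge G ] Σ[ f ∈ Edge G ] (e ≢ f)

Rainbow : ∀ {A : Set} {k : ℕ} → (A → Fin k) → (A → Bool) → Set
Rainbow {A} c S = ∀ (a b : A) → S a ≡ true → S b ≡ true → c a ≡ c b → a ≡ b

RainbowPlus : ∀ {A : Set} {k : ℕ} → (A → Fin k) → (A → Bool) → A → Set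
RainbowPlus {A} c S x =
  ∀ (a b : A) → (S a ≡ true ⊎ a ≡ x) → (S b ≡ true ⊎ b ≡ x) → c a ≡ c b → a ≡ b

StepMinus : ∀ {n} (G : SimpleGraph n) → (Edge G → Bool) → Fin n → Fin n → Set
StepMinus G R i j =
  Σ[ e ∈ Edge G ] (R e ≡ false × ((u e ≡ i × v e ≡ j) ⊎ (u e ≡ j × v e ≡ i)))

SeparatedBy : ∀ {n} (G : SimpleGraph n) → (Edge G → Bool) → Fin n → Fin n → Set
SeparatedBy G R x y = ¬ Star (StepMinus G R) x y

RainbowDisconnecting : ∀ {n k} (G : SimpleGraph n) → (Edge G → Fin k) → Set
RainbowDisconnecting G c =
  ∀ x y → x ≢ y → Σ[ R ∈ (Edge _ → Bool) ] (Rainbow c R × SeparatedBy G R x y)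

IsRd : ∀ {n} → SimpleGraph n → ℕ → Set
IsRd G r =
  (Σ[ c ∈ (Edge G → Fin r) ] RainbowDisconnecting G c)
  × (∀ j (c : Edge G → Fin j) → RainbowDisconnecting G c → r ≤ j)

record Graph : Set₁ where
  field
    V   : Set
    Adj : V → V → Set
open Graph public

LineGraph : ∀ {n} → SimpleGraph n → Graph
LineGraph G = record
  { V   = Edge G
  ; Adj = λ e f → (e ≢ f) × (Σ[ x ∈ Fin _ ] (HasEnd e x × HasEnd f x))
  }

VStep : (H : Graph) → (V H → Bool) → V H → V H → Set
VStep H S a b = Adj H a b × S a ≡ false × S b ≡ false

VStepNoEdge : (H : Graph) → V H → V H → (V H → Bool) → V H → V H → Set
VStepNoEdge H x y S a b =
  Adj H a b × ¬ ((a ≡ x × b ≡ y) ⊎ (a ≡ y × b ≡ x)) × S a ≡ false × S b ≡ false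

RainbowVertexCut : ∀ {k} (H : Graph) → (V H → Fin k) → V H → V H → (V H → Bool) → Set
RainbowVertexCut H c x y S =
    (¬ Adj H x y × S x ≡ false × S y ≡ false × ¬ Star (VStep H S) x y × Rainbow c S)
  ⊎ (Adj H x y × S x ≡ false × S y ≡ false × ¬ Star (VStepNoEdge H x y S) x y
       × (RainbowPlus c S x ⊎ RainbowPlus c S y))

RainbowVertexDisconnecting : ∀ {k} (H : Graph) → (V H → Fin k) → Set
RainbowVertexDisconnecting H c =
  ∀ x y → x ≢ y → Σ[ S ∈ (V H → Bool) ] RainbowVertexCut H c x y S

IsRvd : Graph → ℕ → Set
IsRvd H s =
  (Σ[ c ∈ (V H → Fin s) ] RainbowVertexDisconnecting H c)
  × (∀ j (c : V H → Fin j) → RainbowVertexDisconnecting H c → s ≤ j)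

-- Every rainbow vertex-disconnecting colouring c of L(G) is, read as an edge
-- colouring, rainbow disconnecting for G; hence rd(G) ≤ rvd(L(G)). Given
-- x ≠ y, if one of them, say x, has no neighbour besides y, the edges at x
-- form a rainbow cut (there is at most one). Otherwise pick an edge e at x
-- missing y and an edge f at y missing x, and an e-f-rainbow-vertex-cut S of
-- L(G). A walk from x to y in G - S lifts to a walk from e to f in L(G) - S,
-- so S itself separates x and y when e, f are not adjacent; when they are,
-- the rainbow one of S ∪ {e}, S ∪ {f} separates x and y, because a walk
-- avoiding it lifts to a walk in (L(G) - ef) - S.
module Submission where

open import Defs hiding (sym)
open import Data.Nat using (ℕ; _≤_)
open import Data.Fin using (Fin; _<_; _≟_)
open import Data.Fin.Properties using (<-cmp; <-irrelevant; <-asym; any?)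
open import Data.Bool using (Bool; true; false; _∨_)
open import Data.Bool.Properties using () renaming (_≟_ to _≟ᴮ_)
open import Data.Product using (Σ-syntax; ∃; _×_; _,_; proj₁; proj₂)
open import Data.Sum using (_⊎_; inj₁; inj₂; [_,_])
open import Data.Empty using (⊥-elim)
open import Function using (_∘_)
open import Relation.Nullary using (¬_; Dec; yes; no; does; contradiction)
open import Relation.Nullary.Decidable using (_×-dec_; _⊎-dec_; ¬?; dec-true; decidable-stable)
open import Relation.Binary.PropositionalEquality using (_≡_; _≢_; refl; sym; trans; cong; subst; subst₂)
open import Relation.Binary.Construct.Closure.ReflexiveTransitive
  using (Star; ε; _◅_; _◅◅_; reverse) renaming (map to Star-map)
open import Relation.Binary.Definitions using (tri<; tri≈; tri>)
open import Axiom.UniquenessOfIdentityProofs using (module Decidable⇒UIP)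

does-true : ∀ {A : Set} (a? : Dec A) → does a? ≡ true → A
does-true (yes a) _ = a

module _ {n : ℕ} (G : SimpleGraph n) where

  Joins : Edge G → Fin n → Fin n → Set
  Joins g i j = (u g ≡ i × v g ≡ j) ⊎ (u g ≡ j × v g ≡ i)

  RainbowCut : ∀ {k} → (Edge G → Fin k) → Fin n → Fin n → Set
  RainbowCut c x y = Σ[ R ∈ (Edge G → Bool) ] (Rainbow c R × SeparatedBy G R x y)

  edge-ext : ∀ {g h : Edge G} → u g ≡ u h → v g ≡ v h → g ≡ h
  edge-ext {edge a b a<b p} {edge .a .b a<b′ p′} refl refl
    rewrite <-irrelevant a<b a<b′ | Decidable⇒UIP.≡-irrelevant _≟ᴮ_ p p′ = refl

  _≟ᴱ_ : (g h : Edge G) → Dec (g ≡ h)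
  g ≟ᴱ h with u g ≟ u h | v g ≟ v h
  ... | yes p | yes q = yes (edge-ext p q)
  ... | no p  | _     = no (p ∘ cong u)
  ... | yes _ | no q  = no (q ∘ cong v)

  hasEnd? : (g : Edge G) (x : Fin n) → Dec (HasEnd g x)
  hasEnd? g x = (x ≟ u g) ⊎-dec (x ≟ v g)

  joins-ends : ∀ g {i j} → Joins g i j → HasEnd g i × HasEnd g j
  joins-ends _ (inj₁ (p , q)) = inj₁ (sym p) , inj₂ (sym q)
  joins-ends _ (inj₂ (p , q)) = inj₂ (sym q) , inj₁ (sym p)

  joins-sym : ∀ g {i j} → Joins g i j → Joins g j i
  joins-sym _ (inj₁ p) = inj₂ p
  joins-sym _ (inj₂ p) = inj₁ p

  joins-adjacent : ∀ g {i j} → Joins g i j → Adjacent G i j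
  joins-adjacent g (inj₁ (refl , refl)) = isAdj g
  joins-adjacent g (inj₂ (refl , refl)) = trans (SimpleGraph.sym G (v g) (u g)) (isAdj g)

  joins-unique : ∀ g h {i j} → Joins g i j → Joins h i j → g ≡ h
  joins-unique g h (inj₁ (p , q)) (inj₁ (p′ , q′)) = edge-ext (trans p (sym p′)) (trans q (sym q′))
  joins-unique g h (inj₂ (p , q)) (inj₂ (p′ , q′)) = edge-ext (trans p (sym p′)) (trans q (sym q′))
  joins-unique g h (inj₁ (p , q)) (inj₂ (p′ , q′)) =
    ⊥-elim (<-asym (subst₂ _<_ p q (u<v g)) (subst₂ _<_ p′ q′ (u<v h)))
  joins-unique g h (inj₂ (p , q)) (inj₁ (p′ , q′)) =
    ⊥-elim (<-asym (subst₂ _<_ p q (u<v g)) (subst₂ _<_ p′ q′ (u<v h)))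

  joins-other-end : ∀ g {x} → HasEnd g x → Σ[ z ∈ Fin n ] Joins g x z
  joins-other-end g (inj₁ p) = v g , inj₁ (sym p , refl)
  joins-other-end g (inj₂ p) = u g , inj₂ (refl , sym p)

  joins-only-ends : ∀ g {i j w} → Joins g i j → HasEnd g w → w ≡ i ⊎ w ≡ j
  joins-only-ends _ (inj₁ (refl , refl)) w-end = w-end
  joins-only-ends _ (inj₂ (refl , refl)) (inj₁ p) = inj₂ p
  joins-only-ends _ (inj₂ (refl , refl)) (inj₂ p) = inj₁ p

  edge-between : ∀ {x z} → Adjacent G x z → Σ[ g ∈ Edge G ] Joins g x z
  edge-between {x} {z} a with <-cmp x z
  ... | tri< x<z _ _ = edge x z x<z a , inj₁ (refl , refl)
  ... | tri≈ _ refl _ with () ← trans (sym a) (irrefl G x)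
  ... | tri> _ _ z<x = edge z x z<x (trans (SimpleGraph.sym G z x) a) , inj₂ (refl , refl)

  StepMinus-sym : ∀ {R i j} → StepMinus G R i j → StepMinus G R j i
  StepMinus-sym (h , Rh , joins) = h , Rh , joins-sym h joins

  RainbowCut-sym : ∀ {k} {c : Edge G → Fin k} {x y} → RainbowCut c y x → RainbowCut c x y
  RainbowCut-sym (R , rainbow , separated) = R , rainbow , separated ∘ reverse StepMinus-sym

  incident : Fin n → Edge G → Bool
  incident x g = does (hasEnd? g x)

  pendant-cut : ∀ {k} (c : Edge G → Fin k) {x y} → x ≢ y →
                (∀ z → Adjacent G x z → z ≡ y) → RainbowCut c x y
  pendant-cut c {x} {y} x≢y only-y = incident x , rainbow , separated
    where
    joins-x-y : ∀ g → incident x g ≡ true → Joins g x y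
    joins-x-y g p with joins-other-end g (does-true (hasEnd? g x) p)
    ... | z , joins = subst (Joins g x) (only-y z (joins-adjacent g joins)) joins

    rainbow : Rainbow c (incident x)
    rainbow g h pg ph _ = joins-unique g h (joins-x-y g pg) (joins-x-y h ph)

    separated : SeparatedBy G (incident x) x y
    separated ε = x≢y refl
    separated ((h , Rh , joins) ◅ _)
      with () ← trans (sym Rh) (dec-true (hasEnd? h x) (proj₁ (joins-ends h joins)))

  L : Graph
  L = LineGraph G

  link : ∀ {R : Edge G → Bool} {g h z} → HasEnd g z → R g ≡ false → HasEnd h z → R h ≡ false →
         Star (VStep L R) g h
  link {g = g} {h} gz Rg hz Rh with g ≟ᴱ h
  ... | yes refl = ε
  ... | no g≢h = ((g≢h , _ , gz , hz) , Rg , Rh) ◅ ε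

  lift-walk : ∀ {R : Edge G → Bool} {z y g f} → Star (StepMinus G R) z y →
              HasEnd g z → R g ≡ false → HasEnd f y → R f ≡ false → Star (VStep L R) g f
  lift-walk ε gz Rg fy Rf = link gz Rg fy Rf
  lift-walk ((h , Rh , joins) ◅ walk) gz Rg fy Rf =
    link gz Rg (proj₁ (joins-ends h joins)) Rh ◅◅ lift-walk walk (proj₂ (joins-ends h joins)) Rh fy Rf

  insert : Edge G → (Edge G → Bool) → Edge G → Bool
  insert e S g = does (g ≟ᴱ e) ∨ S g

  insert-false : ∀ {e} S g → insert e S g ≡ false → g ≢ e × S g ≡ false
  insert-false {e} S g p with g ≟ᴱ e
  ... | no g≢e = g≢e , p

  Rainbow-insert : ∀ {k} {c : Edge G → Fin k} {S e} → RainbowPlus c S e → Rainbow c (insert e S)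
  Rainbow-insert {S = S} {e} rainbow a b pa pb = rainbow a b (member a pa) (member b pb)
    where
    member : ∀ g → insert e S g ≡ true → S g ≡ true ⊎ g ≡ e
    member g p with g ≟ᴱ e
    ... | yes g≡e = inj₂ g≡e
    ... | no _ = inj₁ p

  avoid-edge : ∀ {S e f a b} → Star (VStep L (insert e S)) a b → Star (VStepNoEdge L e f S) a b
  avoid-edge {S} = Star-map λ { {a} {b} (ab , Ra , Rb) →
    let a≢e , Sa = insert-false S a Ra
        b≢e , Sb = insert-false S b Rb
    in ab , (λ { (inj₁ (a≡e , _)) → a≢e a≡e ; (inj₂ (_ , b≡e)) → b≢e b≡e }) , Sa , Sb }

  VStepNoEdge-sym : ∀ {S e f a b} → VStepNoEdge L e f S a b → VStepNoEdge L f e S b a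
  VStepNoEdge-sym ((a≢b , w , aw , bw) , not-ef , Sa , Sb) =
    ((a≢b ∘ sym) , w , bw , aw) , (λ { (inj₁ (p , q)) → not-ef (inj₁ (q , p))
                                     ; (inj₂ (p , q)) → not-ef (inj₂ (q , p)) }) , Sb , Sa

  -- A walk from x to y avoiding S ∪ {e} leaves x along an edge h ≠ e, and h ≠ f as f misses x;
  -- so e h is an edge of L - ef, and the rest of the walk lifts.
  separated-by-insert : ∀ {S e f x y} → x ≢ y → HasEnd e x → HasEnd f y → ¬ HasEnd f x →
                        S e ≡ false → S f ≡ false → ¬ Star (VStepNoEdge L e f S) e f →
                        SeparatedBy G (insert e S) x y
  separated-by-insert x≢y _ _ _ _ _ _ ε = x≢y refl
  separated-by-insert {S} {e} {f} {x} x≢y ex fy ¬fx Se Sf no-walk ((h , Rh , joins) ◅ walk) =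
    no-walk (first-step ◅ avoid-edge (lift-walk walk (proj₂ (joins-ends h joins)) Rh fy Rf))
    where
    hx : HasEnd h x
    hx = proj₁ (joins-ends h joins)
    e≢f : e ≢ f
    e≢f e≡f = ¬fx (subst (λ g → HasEnd g x) e≡f ex)
    Rf : insert e S f ≡ false
    Rf with f ≟ᴱ e
    ... | yes f≡e = contradiction (sym f≡e) e≢f
    ... | no _ = Sf
    first-step : VStepNoEdge L e f S e h
    first-step with insert-false S h Rh
    ... | h≢e , Sh = ((h≢e ∘ sym) , x , ex , hx)
                   , (λ { (inj₁ (_ , refl)) → ¬fx hx ; (inj₂ (e≡f , _)) → e≢f e≡f })
                   , Se , Sh

  cut-from-vertex-cut : ∀ {k} (c : Edge G → Fin k) {x y e f S} → x ≢ y →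
                        HasEnd e x → ¬ HasEnd e y → HasEnd f y → ¬ HasEnd f x →
                        RainbowVertexCut L c e f S → RainbowCut c x y
  cut-from-vertex-cut c {S = S} _ ex _ fy _ (inj₁ (_ , Se , Sf , no-walk , rainbow)) =
    S , rainbow , λ walk → no-walk (lift-walk walk ex Se fy Sf)
  cut-from-vertex-cut c {e = e} {S = S} x≢y ex _ fy ¬fx (inj₂ (_ , Se , Sf , no-walk , inj₁ rainbow)) =
    insert e S , Rainbow-insert rainbow , separated-by-insert x≢y ex fy ¬fx Se Sf no-walk
  cut-from-vertex-cut c {f = f} {S = S} x≢y ex ¬ey fy _ (inj₂ (_ , Se , Sf , no-walk , inj₂ rainbow)) =
    RainbowCut-sym (insert f S , Rainbow-insert rainbow ,
      separated-by-insert (x≢y ∘ sym) fy ex ¬ey Sf Se (no-walk ∘ reverse VStepNoEdge-sym))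

  OtherNeighbour : Fin n → Fin n → Set
  OtherNeighbour x y = ∃ λ z → Adjacent G x z × z ≢ y

  other-neighbour? : ∀ x y → Dec (OtherNeighbour x y)
  other-neighbour? x y = any? λ z → (adj G x z ≟ᴮ true) ×-dec ¬? (z ≟ y)

  only-neighbour : ∀ {x y} → ¬ OtherNeighbour x y → ∀ z → Adjacent G x z → z ≡ y
  only-neighbour {y = y} none z a = decidable-stable (z ≟ y) (λ z≢y → none (z , a , z≢y))

  edge-avoiding : ∀ {x y} → x ≢ y → OtherNeighbour x y → Σ[ g ∈ Edge G ] (HasEnd g x × ¬ HasEnd g y)
  edge-avoiding x≢y (z , a , z≢y) with edge-between a
  ... | g , joins = g , proj₁ (joins-ends g joins) , λ gy → [ x≢y ∘ sym , z≢y ∘ sym ] (joins-only-ends g joins gy)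

  rainbow-disconnecting : ∀ {k} (c : Edge G → Fin k) →
                          RainbowVertexDisconnecting L c → RainbowDisconnecting G c
  rainbow-disconnecting c rvd x y x≢y with other-neighbour? x y | other-neighbour? y x
  ... | no none | _ = pendant-cut c x≢y (only-neighbour none)
  ... | yes _ | no none = RainbowCut-sym (pendant-cut c (x≢y ∘ sym) (only-neighbour none))
  ... | yes zx | yes zy with edge-avoiding x≢y zx | edge-avoiding (x≢y ∘ sym) zy
  ... | e , ex , ¬ey | f , fy , ¬fx =
    cut-from-vertex-cut c x≢y ex ¬ey fy ¬fx
      (proj₂ (rvd e f (λ e≡f → ¬fx (subst (λ g → HasEnd g x) e≡f ex))))

theorem4p2 : ∀ {n} (G : SimpleGraph n) → Connected G → AtLeastTwoEdges G →
    ∀ (r s : ℕ) → IsRd G r → IsRvd (LineGraph G) s → r ≤ s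
theorem4p2 G _ _ r s (_ , rd-minimal) ((c , c-rvd) , _) = rd-minimal s c (rainbow-disconnecting G c c-rvd)
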